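{- Let $\mathbf C$ be a category with binary products and a functor $|\cdot|:\mathbf C\to\mathbf{Set}$ which preserves binary products (i.e. $\langle|\pi_1^X|,|\pi_2^X|\rangle:|X\otimes X|\to|X|\times|X|$ is a bijection for every $X$). Then for every morphism $f:X\to Y$ the square $\langle|\pi_1^Y|,|\pi_2^Y|\rangle\circ|f\otimes f|=(|f|\times|f|)\circ\langle|\pi_1^X|,|\pi_2^X|\rangle$ is a weak pullback in $\mathbf{Set}$. As a result, for functors $\bar F:\mathbf C\to\mathbf C$, $G:\mathbf{Set}\to\mathbf{Set}$, a natural transformation $\gamma:|\cdot|\circ\bar F\Rightarrow G\circ|\cdot|$ and a relation lifting $\sigma$ of $G$, the family $$\bar\lambda_X(R)=\langle|\pi_1^{\bar FX}|,|\pi_2^{\bar FX}|\rangle^{ -1}\Big((\gamma_X\times\gamma_X)^{ -1}\big(\sigma_{|X|}(\langle|\pi_1^X|,|\pi_2^X|\rangle[R])\big)\Big)$$ is an indexed morphism $\Psi\to\Psi\bar F$.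
   Context: Binary products in $\mathbf C$: $X\otimes Y$, projections $\pi_1^X,\pi_2^X:X\otimes X\to X$, induced $f\otimes f$. $\Psi X$ is the poset of subsets of $|X\otimes X|$, reindexing along $f:X\to Y$ is $f^*S=|f\otimes f|^{ -1}(S)$. A relation lifting of $G$ is a family of monotone maps $\sigma_Z:\mathcal P(Z\times Z)\to\mathcal P(GZ\times GZ)$ with $\sigma_Z((g\times g)^{ -1}S)=(Gg\times Gg)^{ -1}\sigma_WS$ for all functions $g:Z\to W$. An indexed morphism $\bar\lambda:\Psi\to\Psi\bar F$ is a family of monotone maps $\bar\lambda_X:\Psi X\to\Psi\bar FX$ with $\bar\lambda_X(f^*S)=(\bar Ff)^*\bar\lambda_YS$. $[\,\cdot\,]$ denotes direct image. -}

module Defs where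

open import Level using (Level; _⊔_; suc; 0ℓ)
open import Data.Product using (Σ; ∃; _×_; _,_; proj₁; proj₂)
open import Relation.Binary.PropositionalEquality using (_≡_)
open import Relation.Unary using (Pred; _⊆_; _≐_)
open import Function.Definitions using (Bijective)

record Category (o h : Level) : Set (Level.suc (o ⊔ h)) where
  infixr 9 _∘_
  field
    Obj  : Set o
    Hom  : Obj → Obj → Set h
    id   : ∀ {X} → Hom X X
    _∘_  : ∀ {X Y Z} → Hom Y Z → Hom X Y → Hom X Z
    identityˡ : ∀ {X Y} (f : Hom X Y) → id ∘ f ≡ f
    identityʳ : ∀ {X Y} (f : Hom X Y) → f ∘ id ≡ f
    assoc : ∀ {W X Y Z} (f : Hom Y Z) (g : Hom X Y) (h : Hom W X) →
            (f ∘ g) ∘ h ≡ f ∘ (g ∘ h)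

record BinaryProducts {o h : Level} (C : Category o h) : Set (o ⊔ h) where
  open Category C
  field
    _⊗_  : Obj → Obj → Obj
    π₁   : ∀ {X Y} → Hom (X ⊗ Y) X
    π₂   : ∀ {X Y} → Hom (X ⊗ Y) Y
    ⟨_,_⟩ : ∀ {Z X Y} → Hom Z X → Hom Z Y → Hom Z (X ⊗ Y)
    β₁   : ∀ {Z X Y} (f : Hom Z X) (g : Hom Z Y) → π₁ ∘ ⟨ f , g ⟩ ≡ f
    β₂   : ∀ {Z X Y} (f : Hom Z X) (g : Hom Z Y) → π₂ ∘ ⟨ f , g ⟩ ≡ g
    unique : ∀ {Z X Y} (f : Hom Z X) (g : Hom Z Y) (h : Hom Z (X ⊗ Y)) →
             π₁ ∘ h ≡ f → π₂ ∘ h ≡ g → h ≡ ⟨ f , g ⟩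

  π₁^ : ∀ X → Hom (X ⊗ X) X
  π₁^ X = π₁
  π₂^ : ∀ X → Hom (X ⊗ X) X
  π₂^ X = π₂

  _⊗₁_ : ∀ {X Y} → Hom X Y → Hom X Y → Hom (X ⊗ X) (Y ⊗ Y)
  f ⊗₁ g = ⟨ f ∘ π₁ , g ∘ π₂ ⟩

record SetFunctor {o h : Level} (C : Category o h) : Set (o ⊔ h ⊔ Level.suc 0ℓ) where
  open Category C
  field
    F₀ : Obj → Set
    F₁ : ∀ {X Y} → Hom X Y → F₀ X → F₀ Y
    F-id : ∀ {X} (x : F₀ X) → F₁ (id {X}) x ≡ x
    F-∘  : ∀ {X Y Z} (g : Hom Y Z) (f : Hom X Y) (x : F₀ X) →
           F₁ (g ∘ f) x ≡ F₁ g (F₁ f x)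

record Endofunctor {o h : Level} (C : Category o h) : Set (o ⊔ h) where
  open Category C
  field
    F₀ : Obj → Obj
    F₁ : ∀ {X Y} → Hom X Y → Hom (F₀ X) (F₀ Y)
    F-id : ∀ {X} → F₁ (id {X}) ≡ id
    F-∘  : ∀ {X Y Z} (g : Hom Y Z) (f : Hom X Y) → F₁ (g ∘ f) ≡ F₁ g ∘ F₁ f

record SetEndofunctor : Set₁ where
  field
    G₀ : Set → Set
    G₁ : ∀ {A B : Set} → (A → B) → G₀ A → G₀ B
    G-id : ∀ {A : Set} (x : G₀ A) → G₁ (λ (a : A) → a) x ≡ x
    G-∘  : ∀ {A B D : Set} (g : B → D) (f : A → B) (x : G₀ A) →
           G₁ (λ a → g (f a)) x ≡ G₁ g (G₁ f x)

Subset : Set → Set₁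
Subset A = Pred A 0ℓ

_⁻¹[_] : ∀ {A B : Set} → (A → B) → Subset B → Subset A
(f ⁻¹[ S ]) a = S (f a)

_[_] : ∀ {A B : Set} → (A → B) → Subset A → Subset B
(f [ R ]) b = Σ _ λ a → R a × f a ≡ b

_×ᶠ_ : ∀ {A B A' B' : Set} → (A → B) → (A' → B') → A × A' → B × B'
(f ×ᶠ g) (a , a') = f a , g a'

IsWeakPullback : ∀ {A B D E : Set} (p : A → B) (q : A → D) (g : B → E) (f : D → E) → Set
IsWeakPullback {A} {B} {D} p q g f =
  ((a : A) → g (p a) ≡ f (q a)) ×
  ((b : B) (d : D) → g b ≡ f d → Σ A λ a → p a ≡ b × q a ≡ d)

module _ {o h : Level} {C : Category o h} (P : BinaryProducts C) (U : SetFunctor C) where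
  open Category C
  open BinaryProducts P
  open SetFunctor U renaming (F₀ to ∣_∣ ; F₁ to ∣_∣₁)

  pair : ∀ X → ∣ X ⊗ X ∣ → ∣ X ∣ × ∣ X ∣
  pair X z = ∣ π₁^ X ∣₁ z , ∣ π₂^ X ∣₁ z

  PreservesProducts : Set o
  PreservesProducts = ∀ X → Bijective _≡_ _≡_ (pair X)

  Ψ : Obj → Set₁
  Ψ X = Subset ∣ X ⊗ X ∣

  reindex : ∀ {X Y} → Hom X Y → Ψ Y → Ψ X
  reindex f S = ∣ f ⊗₁ f ∣₁ ⁻¹[ S ]

  IsIndexedMorphism : (F̄ : Endofunctor C) →
    (∀ X → Ψ X → Ψ (Endofunctor.F₀ F̄ X)) → Set (o ⊔ h ⊔ Level.suc 0ℓ)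
  IsIndexedMorphism F̄ λ̄ =
    (∀ X {R S : Ψ X} → R ⊆ S → λ̄ X R ⊆ λ̄ X S) ×
    (∀ {X Y} (f : Hom X Y) (S : Ψ Y) →
       λ̄ X (reindex f S) ≐ reindex (Endofunctor.F₁ F̄ f) (λ̄ Y S))

record NatTrans {o h : Level} {C : Category o h} (U : SetFunctor C)
    (F̄ : Endofunctor C) (G : SetEndofunctor) : Set (o ⊔ h) where
  open Category C
  open SetFunctor U renaming (F₀ to ∣_∣ ; F₁ to ∣_∣₁)
  open Endofunctor F̄ renaming (F₀ to F̄₀ ; F₁ to F̄₁)
  open SetEndofunctor G
  field
    η : ∀ X → ∣ F̄₀ X ∣ → G₀ ∣ X ∣
    natural : ∀ {X Y} (f : Hom X Y) (x : ∣ F̄₀ X ∣) →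
              η Y (∣ F̄₁ f ∣₁ x) ≡ G₁ ∣ f ∣₁ (η X x)

record RelationLifting (G : SetEndofunctor) : Set₁ where
  open SetEndofunctor G
  field
    σ : ∀ (Z : Set) → Subset (Z × Z) → Subset (G₀ Z × G₀ Z)
    monotone : ∀ Z {R S : Subset (Z × Z)} → R ⊆ S → σ Z R ⊆ σ Z S
    natural : ∀ {Z W : Set} (g : Z → W) (S : Subset (W × W)) →
              σ Z ((g ×ᶠ g) ⁻¹[ S ]) ≐ (G₁ g ×ᶠ G₁ g) ⁻¹[ σ W S ]

{-# OPTIONS --safe #-}
module Submission where

open import Defs
open import Level using (Level)
open import Data.Product using (Σ; _×_; _,_; proj₁; proj₂)
open import Function.Definitions using (Injective; Surjective)
open import Relation.Binary.PropositionalEquality using (_≡_; refl; sym; trans; cong; cong₂; subst)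
open import Relation.Unary using (_⊆_; _≐_)
open import Relation.Unary.Properties using (≐-trans)

-- A commuting square of sets whose right edge is injective and whose left edge is surjective is a
-- weak pullback; preservation of products makes both pairing maps bijective. A weak pullback
-- satisfies the Beck–Chevalley condition q[p⁻¹ S] = f⁻¹(g[S]), so the direct image along the
-- pairing commutes with reindexing, and the naturality of σ and γ turns this into the reindexing
-- law of λ̄.

module _ {A B D E : Set} {p : A → B} {q : A → D} {g : B → E} {f : D → E} where

  weakPullback-injective-surjective :
    (∀ a → g (p a) ≡ f (q a)) → Injective _≡_ _≡_ g → Surjective _≡_ _≡_ q →
    IsWeakPullback p q g f
  weakPullback-injective-surjective square g-inj q-surj = square , lift
    where
    lift : ∀ b d → g b ≡ f d → Σ A λ a → p a ≡ b × q a ≡ d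
    lift b d gb≡fd = a , g-inj (trans (square a) (trans (cong f qa≡d) (sym gb≡fd))) , qa≡d
      where
      a : A
      a = proj₁ (q-surj d)
      qa≡d : q a ≡ d
      qa≡d = proj₂ (q-surj d) refl

  image-preimage-weakPullback : IsWeakPullback p q g f →
    (S : Subset B) → (q [ p ⁻¹[ S ] ]) ≐ (f ⁻¹[ g [ S ] ])
  image-preimage-weakPullback (square , lift) S =
    (λ { (a , Spa , qa≡d) → p a , Spa , trans (square a) (cong f qa≡d) })
    , (λ { {d} (b , Sb , gb≡fd) →
         let (a , pa≡b , qa≡d) = lift b d gb≡fd in a , subst S (sym pa≡b) Sb , qa≡d })

image-mono : ∀ {A B : Set} (f : A → B) {R S : Subset A} → R ⊆ S → f [ R ] ⊆ f [ S ]
image-mono f R⊆S (a , Ra , fa≡b) = a , R⊆S Ra , fa≡b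

preimage-square : ∀ {A B D E : Set} {p : A → B} {q : A → D} {g : B → E} {f : D → E} →
  (∀ a → g (p a) ≡ f (q a)) → (S : Subset E) → (p ⁻¹[ g ⁻¹[ S ] ]) ≐ (q ⁻¹[ f ⁻¹[ S ] ])
preimage-square square S = (λ {a} → subst S (square a)) , (λ {a} → subst S (sym (square a)))

preimage-resp-≐ : ∀ {A B : Set} (f : A → B) {R S : Subset B} → R ≐ S → (f ⁻¹[ R ]) ≐ (f ⁻¹[ S ])
preimage-resp-≐ f (R⊆S , S⊆R) = R⊆S , S⊆R

module _ {G : SetEndofunctor} (L : RelationLifting G) where
  open RelationLifting L

  σ-resp-≐ : ∀ Z {R S : Subset (Z × Z)} → R ≐ S → σ Z R ≐ σ Z S
  σ-resp-≐ Z (R⊆S , S⊆R) = monotone Z R⊆S , monotone Z S⊆R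

module _ {o h : Level} {C : Category o h} (P : BinaryProducts C) (U : SetFunctor C) where
  open Category C
  open BinaryProducts P
  open SetFunctor U renaming (F₀ to ∣_∣ ; F₁ to ∣_∣₁)

  π₁-⊗₁ : ∀ {X Y} (f : Hom X Y) (a : ∣ X ⊗ X ∣) → ∣ π₁ ∣₁ (∣ f ⊗₁ f ∣₁ a) ≡ ∣ f ∣₁ (∣ π₁ ∣₁ a)
  π₁-⊗₁ f a = trans (sym (F-∘ π₁ (f ⊗₁ f) a)) (trans (cong (λ k → ∣ k ∣₁ a) (β₁ _ _)) (F-∘ f π₁ a))

  π₂-⊗₁ : ∀ {X Y} (f : Hom X Y) (a : ∣ X ⊗ X ∣) → ∣ π₂ ∣₁ (∣ f ⊗₁ f ∣₁ a) ≡ ∣ f ∣₁ (∣ π₂ ∣₁ a)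
  π₂-⊗₁ f a = trans (sym (F-∘ π₂ (f ⊗₁ f) a)) (trans (cong (λ k → ∣ k ∣₁ a) (β₂ _ _)) (F-∘ f π₂ a))

  pair-⊗₁ : ∀ {X Y} (f : Hom X Y) (a : ∣ X ⊗ X ∣) →
    pair P U Y (∣ f ⊗₁ f ∣₁ a) ≡ (∣ f ∣₁ ×ᶠ ∣ f ∣₁) (pair P U X a)
  pair-⊗₁ f a = cong₂ _,_ (π₁-⊗₁ f a) (π₂-⊗₁ f a)

  pair-weakPullback : PreservesProducts P U → ∀ {X Y} (f : Hom X Y) →
    IsWeakPullback ∣ f ⊗₁ f ∣₁ (pair P U X) (pair P U Y) (∣ f ∣₁ ×ᶠ ∣ f ∣₁)
  pair-weakPullback preserves {X} {Y} f =
    weakPullback-injective-surjective (pair-⊗₁ f) (proj₁ (preserves Y)) (proj₂ (preserves X))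

  module _ (F̄ : Endofunctor C) (G : SetEndofunctor) (γ : NatTrans U F̄ G) (L : RelationLifting G) where
    open Endofunctor F̄ renaming (F₀ to F̄₀ ; F₁ to F̄₁)
    open SetEndofunctor G
    open NatTrans γ renaming (natural to η-natural)
    open RelationLifting L renaming (natural to σ-natural)

    η-pair : ∀ X → ∣ F̄₀ X ⊗ F̄₀ X ∣ → G₀ ∣ X ∣ × G₀ ∣ X ∣
    η-pair X z = (η X ×ᶠ η X) (pair P U (F̄₀ X) z)

    lifted : ∀ X → Ψ P U X → Ψ P U (F̄₀ X)
    lifted X R = η-pair X ⁻¹[ σ ∣ X ∣ (pair P U X [ R ]) ]

    lifted-mono : ∀ X {R S : Ψ P U X} → R ⊆ S → lifted X R ⊆ lifted X S
    lifted-mono X R⊆S = monotone ∣ X ∣ (image-mono (pair P U X) R⊆S)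

    η-pair-⊗₁ : ∀ {X Y} (f : Hom X Y) (z : ∣ F̄₀ X ⊗ F̄₀ X ∣) →
      (G₁ ∣ f ∣₁ ×ᶠ G₁ ∣ f ∣₁) (η-pair X z) ≡ η-pair Y (∣ F̄₁ f ⊗₁ F̄₁ f ∣₁ z)
    η-pair-⊗₁ f z = sym (trans (cong (η _ ×ᶠ η _) (pair-⊗₁ (F̄₁ f) z))
                               (cong₂ _,_ (η-natural f _) (η-natural f _)))

    lifted-reindex : PreservesProducts P U → ∀ {X Y} (f : Hom X Y) (S : Ψ P U Y) →
      lifted X (reindex P U f S) ≐ reindex P U (F̄₁ f) (lifted Y S)
    lifted-reindex preserves {X} {Y} f S =
      ≐-trans (preimage-resp-≐ (η-pair X) σ-step)
              (preimage-square {p = η-pair X} {q = ∣ F̄₁ f ⊗₁ F̄₁ f ∣₁}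
                               {g = G₁ ∣ f ∣₁ ×ᶠ G₁ ∣ f ∣₁} {f = η-pair Y}
                               (η-pair-⊗₁ f) (σ ∣ Y ∣ (pair P U Y [ S ])))
      where
      σ-step : σ ∣ X ∣ (pair P U X [ reindex P U f S ])
             ≐ (G₁ ∣ f ∣₁ ×ᶠ G₁ ∣ f ∣₁) ⁻¹[ σ ∣ Y ∣ (pair P U Y [ S ]) ]
      σ-step = ≐-trans (σ-resp-≐ L ∣ X ∣ (image-preimage-weakPullback (pair-weakPullback preserves f) S))
                       (σ-natural ∣ f ∣₁ (pair P U Y [ S ]))

corollary1 : ∀ {o h : Level} (C : Category o h) (P : BinaryProducts C) (U : SetFunctor C) →
    PreservesProducts P U →
    (∀ {X Y} (f : Category.Hom C X Y) →
      IsWeakPullback (SetFunctor.F₁ U (BinaryProducts._⊗₁_ P f f)) (pair P U X)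
        (pair P U Y) (SetFunctor.F₁ U f ×ᶠ SetFunctor.F₁ U f))
    ×
    (∀ (F̄ : Endofunctor C) (G : SetEndofunctor) (γ : NatTrans U F̄ G) (L : RelationLifting G) →
      IsIndexedMorphism P U F̄ (λ X R →
        pair P U (Endofunctor.F₀ F̄ X) ⁻¹[
          (NatTrans.η γ X ×ᶠ NatTrans.η γ X) ⁻¹[
            RelationLifting.σ L (SetFunctor.F₀ U X) (pair P U X [ R ]) ] ]))
corollary1 C P U preserves =
  pair-weakPullback P U preserves ,
  λ F̄ G γ L → lifted-mono P U F̄ G γ L , lifted-reindex P U F̄ G γ L preserves
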